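{- Let $p,q,r$ be integers, $n\ge0$ an integer, and $x$ a number with $(1+x-x^2)(1-4x-x^2)\neq0$. Then $$\begin{aligned}\sum_{k=0}^n x^kG_{p+k}H_{q-k}K_{r-k}=\frac{1}{(1+x-x^2)(1-4x-x^2)}\Big\{&x^{n+1}\big[x^2(x+3)G_{p+n}H_{q-n}K_{r-n}+(3x-1)G_{p+n+1}H_{q-n-1}K_{r-n-1}\\&\quad+x^2G_{p+n-1}H_{q-n+1}K_{r-n+1}-xG_{p+n+2}H_{q-n-2}K_{r-n-2}\big]\\&-x^2(x+3)G_{p-1}H_{q+1}K_{r+1}-(3x-1)G_pH_qK_r\\&-x^2G_{p-2}H_{q+2}K_{r+2}+xG_{p+1}H_{q-1}K_{r-1}\Big\}.\end{aligned}$$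
   Context: $(G_n),(H_n),(K_n)$, indexed by all integers $n$, are generalized Fibonacci sequences: each satisfies $X_{n+2}=X_{n+1}+X_n$ for all integers $n$, with arbitrary initial values $X_0,X_1$. -}

module Defs where

open import Level using (Level; _⊔_) renaming (suc to lsuc)
open import Algebra.Bundles using (CommutativeRing)
open import Data.Nat using (ℕ) renaming (zero to zeroℕ; suc to sucℕ)
open import Data.Integer using (ℤ; 1ℤ; 0ℤ) renaming (_+_ to _+ℤ_)
open import Relation.Nullary using (¬_)

record Field (c ℓ : Level) : Set (lsuc (c ⊔ ℓ)) where
  field
    commutativeRing : CommutativeRing c ℓ
  open CommutativeRing commutativeRing public
  field
    0≉1     : ¬ (0# ≈ 1#)
    inv     : (a : Carrier) → ¬ (a ≈ 0#) → Carrier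
    inv-r   : (a : Carrier) (a≉0 : ¬ (a ≈ 0#)) → a * inv a a≉0 ≈ 1#

module FieldOps {c ℓ : Level} (F : Field c ℓ) where
  open Field F public

  infixr 8 _^_
  _^_ : Carrier → ℕ → Carrier
  x ^ zeroℕ = 1#
  x ^ sucℕ k = x * x ^ k

  sumTo : ℕ → (ℕ → Carrier) → Carrier
  sumTo zeroℕ f = f zeroℕ
  sumTo (sucℕ n) f = sumTo n f + f (sucℕ n)

  IsGenFib : (ℤ → Carrier) → Set ℓ
  IsGenFib X = (m : ℤ) → X (m +ℤ (1ℤ +ℤ 1ℤ)) ≈ X (m +ℤ 1ℤ) + X m

{-# OPTIONS --safe #-}
-- Write P m = G (p + m) H (q - m) K (r - m) and Φ m for the bracket of the theorem taken at
-- index m, so that the right-hand side is (x ^ (n + 1) Φ n - Φ (-1)) / D. For every m,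
--   D x ^ m P m = x ^ (m + 1) Φ m - x ^ m Φ (m - 1),
-- hence D times the sum telescopes. This identity only involves G, H, K at the five indices
-- m - 2, ..., m + 2; expressing those through two consecutive values of each sequence turns it
-- into a polynomial identity in eight variables, which the ring solver checks.
module Submission where

open import Defs
open import Level using (Level)
open import Algebra.Bundles using (CommutativeRing)
open import Algebra.Bundles.Raw using (RawRing)
open import Algebra.Solver.Ring.AlmostCommutativeRing
  using (_-Raw-AlmostCommutative⟶_; fromCommutativeRing)
open import Data.Nat.Base as ℕ using (ℕ) renaming (zero to zeroℕ; suc to sucℕ)
import Data.Nat.Properties as ℕ
open import Data.Integer.Base as ℤ using (ℤ; 1ℤ; -1ℤ; -[1+_]; _⊖_)
  renaming (_+_ to _+ℤ_; _-_ to _-ℤ_; +_ to ⁺_)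
import Data.Integer.Properties as ℤ
open import Data.Integer.Tactic.RingSolver using (solve-∀)
open import Data.Maybe.Base using (Maybe; just; nothing)
open import Data.Product.Base using (_×_; _,_)
open import Data.Product.Relation.Binary.Pointwise.NonDependent using (Pointwise)
open import Function.Base using (_∘_)
open import Relation.Nullary using (¬_)
open import Relation.Nullary.Decidable using (yes; no)
open import Relation.Binary.PropositionalEquality.Core as ≡ using (_≡_)

module IntegerCoefficients {c ℓ : Level} (R : CommutativeRing c ℓ) where

  open CommutativeRing R
  open import Algebra.Properties.Ring ring using (-0#≈0#; -‿involutive; -‿distribˡ-*; -‿distribʳ-*; -‿+-comm)
  open import Algebra.Properties.CommutativeSemigroup +-commutativeSemigroup using (interchange)
  open import Algebra.Properties.Semiring.Mult.TCOptimised semiring using (1+×; ×-homo-+; ×1-homo-*) renaming (_×_ to _×′_)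
  open import Relation.Binary.Reasoning.Setoid setoid

  ⟦_⟧ℤ : ℤ → Carrier
  ⟦ ⁺ n ⟧ℤ      = n ×′ 1#
  ⟦ -[1+ n ] ⟧ℤ = - (sucℕ n ×′ 1#)

  private
    ⟦⟧ℤ-cong : ∀ {i j} → i ≡ j → ⟦ i ⟧ℤ ≈ ⟦ j ⟧ℤ
    ⟦⟧ℤ-cong ≡.refl = refl

    1+a-1+b≈a-b : ∀ a b → (1# + a) - (1# + b) ≈ a - b
    1+a-1+b≈a-b a b = begin
      (1# + a) - (1# + b)      ≈⟨ +-congˡ (-‿+-comm 1# b) ⟨
      (1# + a) + (- 1# + - b)  ≈⟨ interchange 1# a (- 1#) (- b) ⟩
      (1# - 1#) + (a - b)      ≈⟨ +-congʳ (-‿inverseʳ 1#) ⟩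
      0# + (a - b)             ≈⟨ +-identityˡ _ ⟩
      a - b                    ∎

  ⟦⟧ℤ-homo-⊖ : ∀ m n → ⟦ m ⊖ n ⟧ℤ ≈ m ×′ 1# - n ×′ 1#
  ⟦⟧ℤ-homo-⊖ m        zeroℕ    = sym (trans (+-congˡ -0#≈0#) (+-identityʳ _))
  ⟦⟧ℤ-homo-⊖ zeroℕ    (sucℕ n) = sym (+-identityˡ _)
  ⟦⟧ℤ-homo-⊖ (sucℕ m) (sucℕ n) = begin
    ⟦ sucℕ m ⊖ sucℕ n ⟧ℤ             ≈⟨ ⟦⟧ℤ-cong (ℤ.[1+m]⊖[1+n]≡m⊖n m n) ⟩
    ⟦ m ⊖ n ⟧ℤ                       ≈⟨ ⟦⟧ℤ-homo-⊖ m n ⟩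
    m ×′ 1# - n ×′ 1#                ≈⟨ 1+a-1+b≈a-b _ _ ⟨
    (1# + m ×′ 1#) - (1# + n ×′ 1#)  ≈⟨ +-cong (1+× m 1#) (-‿cong (1+× n 1#)) ⟨
    sucℕ m ×′ 1# - sucℕ n ×′ 1#      ∎

  ⟦⟧ℤ-homo-+ : ∀ i j → ⟦ i ℤ.+ j ⟧ℤ ≈ ⟦ i ⟧ℤ + ⟦ j ⟧ℤ
  ⟦⟧ℤ-homo-+ (⁺ m)    (⁺ n)    = ×-homo-+ 1# m n
  ⟦⟧ℤ-homo-+ (⁺ m)    -[1+ n ] = ⟦⟧ℤ-homo-⊖ m (sucℕ n)
  ⟦⟧ℤ-homo-+ -[1+ m ] (⁺ n)    = trans (⟦⟧ℤ-homo-⊖ n (sucℕ m)) (+-comm _ _)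
  ⟦⟧ℤ-homo-+ -[1+ m ] -[1+ n ] = begin
    - (sucℕ (sucℕ (m ℕ.+ n)) ×′ 1#)  ≡⟨ ≡.cong (λ k → - (sucℕ k ×′ 1#)) (ℕ.+-suc m n) ⟨
    - ((sucℕ m ℕ.+ sucℕ n) ×′ 1#)    ≈⟨ -‿cong (×-homo-+ 1# (sucℕ m) (sucℕ n)) ⟩
    - (sucℕ m ×′ 1# + sucℕ n ×′ 1#)  ≈⟨ -‿+-comm _ _ ⟨
    - (sucℕ m ×′ 1#) + - (sucℕ n ×′ 1#)  ∎

  ⟦⟧ℤ-homo-neg : ∀ i → ⟦ ℤ.- i ⟧ℤ ≈ - ⟦ i ⟧ℤ
  ⟦⟧ℤ-homo-neg (⁺ zeroℕ)  = sym -0#≈0#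
  ⟦⟧ℤ-homo-neg (⁺ sucℕ n) = refl
  ⟦⟧ℤ-homo-neg -[1+ n ]  = sym (-‿involutive _)

  private
    ⟦⟧ℤ-homo-*-pos : ∀ m j → ⟦ ⁺ m ℤ.* j ⟧ℤ ≈ m ×′ 1# * ⟦ j ⟧ℤ
    ⟦⟧ℤ-homo-*-pos m (⁺ n)    = trans (⟦⟧ℤ-cong (≡.sym (ℤ.pos-* m n))) (×1-homo-* m n)
    ⟦⟧ℤ-homo-*-pos m -[1+ n ] = begin
      ⟦ ⁺ m ℤ.* ℤ.- ⁺ sucℕ n ⟧ℤ    ≈⟨ ⟦⟧ℤ-cong (ℤ.neg-distribʳ-* (⁺ m) (⁺ sucℕ n)) ⟨
      ⟦ ℤ.- (⁺ m ℤ.* ⁺ sucℕ n) ⟧ℤ  ≈⟨ ⟦⟧ℤ-homo-neg (⁺ m ℤ.* ⁺ sucℕ n) ⟩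
      - ⟦ ⁺ m ℤ.* ⁺ sucℕ n ⟧ℤ      ≈⟨ -‿cong (⟦⟧ℤ-homo-*-pos m (⁺ sucℕ n)) ⟩
      - (m ×′ 1# * sucℕ n ×′ 1#)   ≈⟨ -‿distribʳ-* _ _ ⟩
      m ×′ 1# * - (sucℕ n ×′ 1#)   ∎

  ⟦⟧ℤ-homo-* : ∀ i j → ⟦ i ℤ.* j ⟧ℤ ≈ ⟦ i ⟧ℤ * ⟦ j ⟧ℤ
  ⟦⟧ℤ-homo-* (⁺ m)    j = ⟦⟧ℤ-homo-*-pos m j
  ⟦⟧ℤ-homo-* -[1+ m ] j = begin
    ⟦ ℤ.- ⁺ sucℕ m ℤ.* j ⟧ℤ    ≈⟨ ⟦⟧ℤ-cong (ℤ.neg-distribˡ-* (⁺ sucℕ m) j) ⟨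
    ⟦ ℤ.- (⁺ sucℕ m ℤ.* j) ⟧ℤ  ≈⟨ ⟦⟧ℤ-homo-neg (⁺ sucℕ m ℤ.* j) ⟩
    - ⟦ ⁺ sucℕ m ℤ.* j ⟧ℤ      ≈⟨ -‿cong (⟦⟧ℤ-homo-*-pos (sucℕ m) j) ⟩
    - (sucℕ m ×′ 1# * ⟦ j ⟧ℤ)  ≈⟨ -‿distribˡ-* _ _ ⟩
    - (sucℕ m ×′ 1#) * ⟦ j ⟧ℤ  ∎

  ℤ⟶R : (CommutativeRing.rawRing ℤ.+-*-commutativeRing) -Raw-AlmostCommutative⟶ fromCommutativeRing R
  ℤ⟶R = record
    { ⟦_⟧    = ⟦_⟧ℤ
    ; +-homo = ⟦⟧ℤ-homo-+
    ; *-homo = ⟦⟧ℤ-homo-*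
    ; -‿homo = ⟦⟧ℤ-homo-neg
    ; 0-homo = refl
    ; 1-homo = refl
    }

  ⟦⟧ℤ-equal? : ∀ i j → Maybe (⟦ i ⟧ℤ ≈ ⟦ j ⟧ℤ)
  ⟦⟧ℤ-equal? i j with i ℤ.≟ j
  ... | yes i≡j = just (⟦⟧ℤ-cong i≡j)
  ... | no _    = nothing

  open import Algebra.Solver.Ring (CommutativeRing.rawRing ℤ.+-*-commutativeRing) (fromCommutativeRing R) ℤ⟶R ⟦⟧ℤ-equal? public

  polynomialRawRing : ℕ → RawRing _ _
  polynomialRawRing n = record
    { Carrier = Polynomial n
    ; _≈_     = _≡_
    ; _+_     = _:+_
    ; _*_     = _:*_
    ; -_      = :-_
    ; 0#      = con (⁺ 0)
    ; 1#      = con 1ℤ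
    }

-- Stated over an arbitrary raw ring so that the same definitions also build the solver's
-- polynomial expressions in windowIdentity.
module BoundaryPolynomials {c ℓ : Level} (R : RawRing c ℓ) where

  open RawRing R

  infixl 6 _-_
  _-_ : Carrier → Carrier → Carrier
  x - y = x + - y

  Triple : Set c
  Triple = Carrier × Carrier × Carrier

  term : Carrier → Triple → Carrier
  term a (u , v , w) = a * u * v * w

  D : Carrier → Carrier
  D x = (1# + x - x * x) * (1# - (1# + 1# + 1# + 1#) * x - x * x)

  Ψ : Carrier → Triple → Triple → Triple → Triple → Carrier
  Ψ x t₀ t₁ t₋₁ t₂ =
    term (x * x * (x + (1# + 1# + 1#))) t₀ + term ((1# + 1# + 1#) * x - 1#) t₁
    + term (x * x) t₋₁ - term x t₂

  -- (g, h, k) at offsets -2, ..., 2, for g satisfying the Fibonacci recurrence and h, k the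
  -- reversed one, written through g at -1, 0 and h, k at 0, 1.
  module Window (g₋₁ g₀ h₀ h₁ k₀ k₁ : Carrier) where
    w₋₂ w₋₁ w₀ w₁ w₂ : Triple
    w₋₂ = (g₀ - g₋₁ , (h₀ + h₁) + h₀ , (k₀ + k₁) + k₀)
    w₋₁ = (g₋₁ , h₀ + h₁ , k₀ + k₁)
    w₀  = (g₀ , h₀ , k₀)
    w₁  = (g₀ + g₋₁ , h₁ , k₁)
    w₂  = ((g₀ + g₋₁) + g₀ , h₀ - h₁ , k₀ - k₁)

module _ {c ℓ : Level} (F : Field c ℓ) where

  open FieldOps F hiding (zero)
  open IntegerCoefficients commutativeRing using (solve; _:=_; _:+_; _:*_; _:-_; polynomialRawRing)
  open BoundaryPolynomials rawRing using (Triple; term; D; Ψ; module Window)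
  open import Relation.Binary.Reasoning.Setoid setoid

  windowIdentity : ∀ x a g₋₁ g₀ h₀ h₁ k₀ k₁ → let open Window g₋₁ g₀ h₀ h₁ k₀ k₁ in
    D x * term a w₀ ≈ (x * a) * Ψ x w₀ w₁ w₋₁ w₂ - a * Ψ x w₋₁ w₀ w₋₂ w₁
  windowIdentity = solve 8 (λ x a g₋₁ g₀ h₀ h₁ k₀ k₁ → let open P.Window g₋₁ g₀ h₀ h₁ k₀ k₁ in
      P.D x :* P.term a w₀ := (x :* a) :* P.Ψ x w₀ w₁ w₋₁ w₂ :- a :* P.Ψ x w₋₁ w₀ w₋₂ w₁) refl
    where module P = BoundaryPolynomials (polynomialRawRing 8)

  infix 4 _≈₃_
  _≈₃_ : Triple → Triple → Set ℓ
  _≈₃_ = Pointwise _≈_ (Pointwise _≈_ _≈_)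

  ≈₃-refl : ∀ {t} → t ≈₃ t
  ≈₃-refl = refl , refl , refl

  term-cong : ∀ a {t t′} → t ≈₃ t′ → term a t ≈ term a t′
  term-cong a (u≈u′ , v≈v′ , w≈w′) = *-cong (*-cong (*-congˡ u≈u′) v≈v′) w≈w′

  Ψ-cong : ∀ x {t₀ t₀′ t₁ t₁′ t₋₁ t₋₁′ t₂ t₂′} → t₀ ≈₃ t₀′ → t₁ ≈₃ t₁′ → t₋₁ ≈₃ t₋₁′ → t₂ ≈₃ t₂′ →
           Ψ x t₀ t₁ t₋₁ t₂ ≈ Ψ x t₀′ t₁′ t₋₁′ t₂′
  Ψ-cong x e₀ e₁ e₋₁ e₂ =
    +-cong (+-cong (+-cong (term-cong _ e₀) (term-cong _ e₁)) (term-cong _ e₋₁)) (-‿cong (term-cong x e₂))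

  x≈y+z⇒z≈x-y : ∀ {x y z} → x ≈ y + z → z ≈ x - y
  x≈y+z⇒z≈x-y {x} {y} {z} x≈y+z = begin
    z            ≈⟨ solve 2 (λ y z → z := (y :+ z) :- y) refl y z ⟩
    (y + z) - y  ≈⟨ +-congʳ x≈y+z ⟨
    x - y        ∎

  x*y≈z⇒y≈x⁻¹*z : ∀ {x y z} (x≉0 : ¬ x ≈ 0#) → x * y ≈ z → y ≈ inv x x≉0 * z
  x*y≈z⇒y≈x⁻¹*z {x} {y} {z} x≉0 x*y≈z = begin
    y                    ≈⟨ *-identityˡ y ⟨
    1# * y               ≈⟨ *-congʳ (trans (*-comm _ _) (inv-r x x≉0)) ⟨
    inv x x≉0 * x * y    ≈⟨ *-assoc _ _ _ ⟩
    inv x x≉0 * (x * y)  ≈⟨ *-congˡ x*y≈z ⟩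
    inv x x≉0 * z        ∎

  x-[a+b+c-d]≈x-a-b-c+d : ∀ x a b c d → x - (a + b + c - d) ≈ x - a - b - c + d
  x-[a+b+c-d]≈x-a-b-c+d =
    solve 5 (λ x a b c d → x :- (a :+ b :+ c :- d) := x :- a :- b :- c :+ d) refl

  sumTo-cong : ∀ {f f′ : ℕ → Carrier} → (∀ k → f k ≈ f′ k) → ∀ n → sumTo n f ≈ sumTo n f′
  sumTo-cong f≈f′ zeroℕ    = f≈f′ zeroℕ
  sumTo-cong f≈f′ (sucℕ n) = +-cong (sumTo-cong f≈f′ n) (f≈f′ (sucℕ n))

  *-distribˡ-sumTo : ∀ a f n → a * sumTo n f ≈ sumTo n (λ k → a * f k)
  *-distribˡ-sumTo a f zeroℕ    = refl
  *-distribˡ-sumTo a f (sucℕ n) = trans (distribˡ a _ _) (+-congʳ (*-distribˡ-sumTo a f n))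

  sumTo-telescope : ∀ (u : ℕ → Carrier) n → sumTo n (λ k → u (sucℕ k) - u k) ≈ u (sucℕ n) - u 0
  sumTo-telescope u zeroℕ    = refl
  sumTo-telescope u (sucℕ n) = begin
    sumTo n (λ k → u (sucℕ k) - u k) + (u (sucℕ (sucℕ n)) - u (sucℕ n))
      ≈⟨ +-congʳ (sumTo-telescope u n) ⟩
    (u (sucℕ n) - u 0) + (u (sucℕ (sucℕ n)) - u (sucℕ n))
      ≈⟨ solve 3 (λ a b c → (b :- a) :+ (c :- b) := c :- a) refl (u 0) (u (sucℕ n)) (u (sucℕ (sucℕ n))) ⟩
    u (sucℕ (sucℕ n)) - u 0 ∎

  IsFibonacci : (ℤ → Carrier) → Set ℓ
  IsFibonacci g = ∀ i → g (ℤ.suc (ℤ.suc i)) ≈ g (ℤ.suc i) + g i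

  IsReverseFibonacci : (ℤ → Carrier) → Set ℓ
  IsReverseFibonacci h = ∀ i → h i ≈ h (ℤ.suc i) + h (ℤ.suc (ℤ.suc i))

  isGenFib-at : ∀ {X} → IsGenFib X → ∀ m {i j} → i ≡ m +ℤ (1ℤ +ℤ 1ℤ) → j ≡ m +ℤ 1ℤ → X i ≈ X j + X m
  isGenFib-at X-fib m ≡.refl ≡.refl = X-fib m

  isGenFib⇒isFibonacci-translate : ∀ {X} → IsGenFib X → ∀ a → IsFibonacci (λ i → X (a +ℤ i))
  isGenFib⇒isFibonacci-translate X-fib a i =
    isGenFib-at X-fib (a +ℤ i) (shift₂ a i) (shift₁ a i)
    where
    shift₂ : ∀ a i → a +ℤ (1ℤ +ℤ (1ℤ +ℤ i)) ≡ a +ℤ i +ℤ (1ℤ +ℤ 1ℤ)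
    shift₂ = solve-∀
    shift₁ : ∀ a i → a +ℤ (1ℤ +ℤ i) ≡ a +ℤ i +ℤ 1ℤ
    shift₁ = solve-∀

  isGenFib⇒isReverseFibonacci-reflect : ∀ {X} → IsGenFib X → ∀ a → IsReverseFibonacci (λ i → X (a -ℤ i))
  isGenFib⇒isReverseFibonacci-reflect X-fib a i =
    isGenFib-at X-fib (a -ℤ ℤ.suc (ℤ.suc i)) (shift₂ a i) (shift₁ a i)
    where
    shift₂ : ∀ a i → a -ℤ i ≡ a -ℤ (1ℤ +ℤ (1ℤ +ℤ i)) +ℤ (1ℤ +ℤ 1ℤ)
    shift₂ = solve-∀
    shift₁ : ∀ a i → a -ℤ (1ℤ +ℤ i) ≡ a -ℤ (1ℤ +ℤ (1ℤ +ℤ i)) +ℤ 1ℤ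
    shift₁ = solve-∀

  module _ {g : ℤ → Carrier} (g-fib : IsFibonacci g) (j : ℤ) where

    fibonacci-suc : g (ℤ.suc j) ≈ g j + g (ℤ.pred j)
    fibonacci-suc = begin
      g (ℤ.suc j)                          ≡⟨ ≡.cong (g ∘ ℤ.suc) (ℤ.suc-pred j) ⟨
      g (ℤ.suc (ℤ.suc (ℤ.pred j)))         ≈⟨ g-fib (ℤ.pred j) ⟩
      g (ℤ.suc (ℤ.pred j)) + g (ℤ.pred j)  ≡⟨ ≡.cong (λ i → g i + g (ℤ.pred j)) (ℤ.suc-pred j) ⟩
      g j + g (ℤ.pred j)                   ∎

    fibonacci-suc² : g (ℤ.suc (ℤ.suc j)) ≈ (g j + g (ℤ.pred j)) + g j
    fibonacci-suc² = trans (g-fib j) (+-congʳ fibonacci-suc)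

    fibonacci-pred² : g (ℤ.pred (ℤ.pred j)) ≈ g j - g (ℤ.pred j)
    fibonacci-pred² = x≈y+z⇒z≈x-y (begin
      g j
        ≡⟨ ≡.cong g (ℤ.suc-pred j) ⟨
      g (ℤ.suc (ℤ.pred j))
        ≡⟨ ≡.cong (g ∘ ℤ.suc) (ℤ.suc-pred (ℤ.pred j)) ⟨
      g (ℤ.suc (ℤ.suc (ℤ.pred (ℤ.pred j))))
        ≈⟨ g-fib (ℤ.pred (ℤ.pred j)) ⟩
      g (ℤ.suc (ℤ.pred (ℤ.pred j))) + g (ℤ.pred (ℤ.pred j))
        ≡⟨ ≡.cong (λ i → g i + g (ℤ.pred (ℤ.pred j))) (ℤ.suc-pred (ℤ.pred j)) ⟩
      g (ℤ.pred j) + g (ℤ.pred (ℤ.pred j))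
        ∎)

  module _ {h : ℤ → Carrier} (h-fib : IsReverseFibonacci h) (j : ℤ) where

    reverseFibonacci-pred : h (ℤ.pred j) ≈ h j + h (ℤ.suc j)
    reverseFibonacci-pred = begin
      h (ℤ.pred j)
        ≈⟨ h-fib (ℤ.pred j) ⟩
      h (ℤ.suc (ℤ.pred j)) + h (ℤ.suc (ℤ.suc (ℤ.pred j)))
        ≡⟨ ≡.cong (λ i → h i + h (ℤ.suc i)) (ℤ.suc-pred j) ⟩
      h j + h (ℤ.suc j)
        ∎

    reverseFibonacci-pred² : h (ℤ.pred (ℤ.pred j)) ≈ (h j + h (ℤ.suc j)) + h j
    reverseFibonacci-pred² = begin
      h (ℤ.pred (ℤ.pred j))
        ≈⟨ h-fib (ℤ.pred (ℤ.pred j)) ⟩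
      h (ℤ.suc (ℤ.pred (ℤ.pred j))) + h (ℤ.suc (ℤ.suc (ℤ.pred (ℤ.pred j))))
        ≡⟨ ≡.cong (λ i → h i + h (ℤ.suc i)) (ℤ.suc-pred (ℤ.pred j)) ⟩
      h (ℤ.pred j) + h (ℤ.suc (ℤ.pred j))
        ≡⟨ ≡.cong (λ i → h (ℤ.pred j) + h i) (ℤ.suc-pred j) ⟩
      h (ℤ.pred j) + h j
        ≈⟨ +-congʳ reverseFibonacci-pred ⟩
      (h j + h (ℤ.suc j)) + h j
        ∎

    reverseFibonacci-suc² : h (ℤ.suc (ℤ.suc j)) ≈ h j - h (ℤ.suc j)
    reverseFibonacci-suc² = x≈y+z⇒z≈x-y (h-fib j)

  module Boundary (x : Carrier) {g h k : ℤ → Carrier}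
    (g-fib : IsFibonacci g) (h-fib : IsReverseFibonacci h) (k-fib : IsReverseFibonacci k) where

    at : ℤ → Triple
    at i = (g i , h i , k i)

    Φ : ℤ → Carrier
    Φ i = Ψ x (at i) (at (ℤ.suc i)) (at (ℤ.pred i)) (at (ℤ.suc (ℤ.suc i)))

    Φ-pred : ∀ j → Φ (ℤ.pred j) ≡ Ψ x (at (ℤ.pred j)) (at j) (at (ℤ.pred (ℤ.pred j))) (at (ℤ.suc j))
    Φ-pred j rewrite ℤ.suc-pred j = ≡.refl

    D-telescopes : ∀ a j → D x * term a (at j) ≈ (x * a) * Φ j - a * Φ (ℤ.pred j)
    D-telescopes a j = begin
      D x * term a w₀                                     ≈⟨ windowIdentity x a _ _ _ _ _ _ ⟩
      (x * a) * Ψ x w₀ w₁ w₋₁ w₂ - a * Ψ x w₋₁ w₀ w₋₂ w₁  ≈⟨ +-cong (*-congˡ Φ≈) (-‿cong (*-congˡ Φ-pred≈)) ⟨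
      (x * a) * Φ j - a * Φ (ℤ.pred j)                    ∎
      where
      open Window (g (ℤ.pred j)) (g j) (h j) (h (ℤ.suc j)) (k j) (k (ℤ.suc j))
      at-pred : at (ℤ.pred j) ≈₃ w₋₁
      at-pred = refl , reverseFibonacci-pred h-fib j , reverseFibonacci-pred k-fib j
      at-suc : at (ℤ.suc j) ≈₃ w₁
      at-suc = fibonacci-suc g-fib j , refl , refl
      at-pred² : at (ℤ.pred (ℤ.pred j)) ≈₃ w₋₂
      at-pred² = fibonacci-pred² g-fib j , reverseFibonacci-pred² h-fib j , reverseFibonacci-pred² k-fib j
      at-suc² : at (ℤ.suc (ℤ.suc j)) ≈₃ w₂
      at-suc² = fibonacci-suc² g-fib j , reverseFibonacci-suc² h-fib j , reverseFibonacci-suc² k-fib j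
      Φ≈ : Φ j ≈ Ψ x w₀ w₁ w₋₁ w₂
      Φ≈ = Ψ-cong x ≈₃-refl at-suc at-pred at-suc²
      Φ-pred≈ : Φ (ℤ.pred j) ≈ Ψ x w₋₁ w₀ w₋₂ w₁
      Φ-pred≈ = trans (reflexive (Φ-pred j)) (Ψ-cong x at-pred ≈₃-refl at-pred² at-suc)

    D*sum≈boundary : ∀ n → D x * sumTo n (λ i → term (x ^ i) (at (⁺ i))) ≈ x ^ sucℕ n * Φ (⁺ n) - Φ -1ℤ
    D*sum≈boundary n = begin
      D x * sumTo n (λ i → term (x ^ i) (at (⁺ i)))  ≈⟨ *-distribˡ-sumTo (D x) _ n ⟩
      sumTo n (λ i → D x * term (x ^ i) (at (⁺ i)))  ≈⟨ sumTo-cong (λ i → D-telescopes (x ^ i) (⁺ i)) n ⟩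
      sumTo n (λ i → u (sucℕ i) - u i)               ≈⟨ sumTo-telescope u n ⟩
      u (sucℕ n) - u 0                               ≈⟨ +-congˡ (-‿cong (*-identityˡ (Φ -1ℤ))) ⟩
      x ^ sucℕ n * Φ (⁺ n) - Φ -1ℤ                   ∎
      where
      -- u (sucℕ i) is definitionally x ^ sucℕ i * Φ (⁺ i): ℤ.pred (⁺ sucℕ i) reduces to ⁺ i.
      u : ℕ → Carrier
      u i = x ^ i * Φ (ℤ.pred (⁺ i))

mainTheorem9 : {c ℓ : Level} (F : Field c ℓ) →
  let open FieldOps F in
  (G H K : ℤ → Carrier) → IsGenFib G → IsGenFib H → IsGenFib K →
  (p q r : ℤ) (n : ℕ) (x : Carrier) →
  (D≉0 : ¬ ((1# + x - x * x) * (1# - (1# + 1# + 1# + 1#) * x - x * x) ≈ 0#)) →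
  sumTo n (λ k → x ^ k * G (p +ℤ ⁺ k) * H (q -ℤ ⁺ k) * K (r -ℤ ⁺ k))
    ≈ inv ((1# + x - x * x) * (1# - (1# + 1# + 1# + 1#) * x - x * x)) D≉0 *
      ( x ^ sucℕ n *
          ( x * x * (x + (1# + 1# + 1#)) * G (p +ℤ ⁺ n) * H (q -ℤ ⁺ n) * K (r -ℤ ⁺ n)
          + ((1# + 1# + 1#) * x - 1#) * G (p +ℤ ⁺ sucℕ n) * H (q -ℤ ⁺ sucℕ n) * K (r -ℤ ⁺ sucℕ n)
          + x * x * G (p +ℤ ⁺ n -ℤ 1ℤ) * H (q -ℤ ⁺ n +ℤ 1ℤ) * K (r -ℤ ⁺ n +ℤ 1ℤ)
          - x * G (p +ℤ ⁺ sucℕ (sucℕ n)) * H (q -ℤ ⁺ sucℕ (sucℕ n)) * K (r -ℤ ⁺ sucℕ (sucℕ n)) )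
      - x * x * (x + (1# + 1# + 1#)) * G (p -ℤ 1ℤ) * H (q +ℤ 1ℤ) * K (r +ℤ 1ℤ)
      - ((1# + 1# + 1#) * x - 1#) * G p * H q * K r
      - x * x * G (p -ℤ (1ℤ +ℤ 1ℤ)) * H (q +ℤ (1ℤ +ℤ 1ℤ)) * K (r +ℤ (1ℤ +ℤ 1ℤ))
      + x * G (p +ℤ 1ℤ) * H (q -ℤ 1ℤ) * K (r -ℤ 1ℤ) )
mainTheorem9 F G H K G-fib H-fib K-fib p q r n x D≉0 =
  x*y≈z⇒y≈x⁻¹*z F D≉0
    (trans (D*sum≈boundary n)
    (trans (+-cong (*-congˡ (Ψ-cong F x (≈₃-refl F) (≈₃-refl F) at-pred-n (≈₃-refl F)))
                   (-‿cong (Ψ-cong F x (≈₃-refl F) at-0 (≈₃-refl F) (≈₃-refl F))))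
           (x-[a+b+c-d]≈x-a-b-c+d F _ _ _ _ _)))
  where
  open FieldOps F hiding (zero)
  open Boundary F x (isGenFib⇒isFibonacci-translate F G-fib p)
    (isGenFib⇒isReverseFibonacci-reflect F H-fib q) (isGenFib⇒isReverseFibonacci-reflect F K-fib r)

  +-pred : ∀ a i → a +ℤ (-1ℤ +ℤ i) ≡ a +ℤ i -ℤ 1ℤ
  +-pred = solve-∀
  -‿pred : ∀ a i → a -ℤ (-1ℤ +ℤ i) ≡ a -ℤ i +ℤ 1ℤ
  -‿pred = solve-∀

  at-pred-n : _≈₃_ F (at (ℤ.pred (⁺ n))) (G (p +ℤ ⁺ n -ℤ 1ℤ) , H (q -ℤ ⁺ n +ℤ 1ℤ) , K (r -ℤ ⁺ n +ℤ 1ℤ))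
  at-pred-n = reflexive (≡.cong G (+-pred p (⁺ n))) , reflexive (≡.cong H (-‿pred q (⁺ n))) ,
              reflexive (≡.cong K (-‿pred r (⁺ n)))

  at-0 : _≈₃_ F (at (⁺ 0)) (G p , H q , K r)
  at-0 = reflexive (≡.cong G (ℤ.+-identityʳ p)) , reflexive (≡.cong H (ℤ.+-identityʳ q)) ,
         reflexive (≡.cong K (ℤ.+-identityʳ r))
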